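{- Let $a\geq 4$ and $m\geq a^2-a+2$ be integers, let $C(m,a)=\left\lceil\frac{m-1}{a}\left\lceil\frac{m-1}{a}\right\rceil\right\rceil$, and suppose the set $\{1,\dots,C(m,a)\}$ is colored red and blue so that there is no solution of $x_1+\cdots+x_{m-1}=ax_m$ with all $x_i\in\{1,\dots,C(m,a)\}$ of the same color. Suppose further that $a-2$ and $a-1$ are both red. Then the numbers $1,2,\dots,a$ are all red.
   Context: Solutions need not have distinct entries. -}

module Defs where

open import Data.Nat using (ℕ; zero; suc; _+_; _*_; _∸_; _≤_; NonZero)
open import Data.Nat.DivMod using (_/_)
open import Data.Fin using (Fin; zero; suc)
open import Data.Bool using (Bool; true)
open import Relation.Binary.PropositionalEquality using (_≡_)
open import Data.Product using (Σ; _×_)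

⌈_/_⌉ : (n a : ℕ) → .{{NonZero a}} → ℕ
⌈ n / a ⌉ = (n + a ∸ 1) / a

-- C(m,a) = ⌈ (m-1)/a · ⌈ (m-1)/a ⌉ ⌉ = ⌈ ((m-1) · ⌈(m-1)/a⌉) / a ⌉
C : (m a : ℕ) → .{{NonZero a}} → ℕ
C m a = ⌈ (m ∸ 1) * ⌈ m ∸ 1 / a ⌉ / a ⌉

∑ : (k : ℕ) → (Fin k → ℕ) → ℕ
∑ zero    f = 0
∑ (suc k) f = f zero + ∑ k (λ i → f (suc i))

-- colorings: true = red, false = blue
Coloring : Set
Coloring = ℕ → Bool

red : Coloring → ℕ → Set
red χ n = χ n ≡ true

InRange : ℕ → ℕ → Set
InRange N n = 1 ≤ n × n ≤ N

-- a monochromatic solution of x₁+⋯+x_{m-1} = a·x_m in {1,…,N}: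
-- x : Fin (m-1) → ℕ are x₁,…,x_{m-1}, y is x_m
MonoSolution : (m a N : ℕ) → Coloring → Set
MonoSolution m a N χ =
  Σ (Fin (m ∸ 1) → ℕ) λ x → Σ ℕ λ y →
    ((i : Fin (m ∸ 1)) → InRange N (x i)) × InRange N y ×
    ((i : Fin (m ∸ 1)) → χ (x i) ≡ χ y) ×
    (∑ (m ∸ 1) x ≡ a * y)

-- Write a = c + 2 and n = m − 1; since C(m, a) ≥ n, every monochromatic solution with entries in
-- {1, …, n} is forbidden, and all solutions used are made of at most three constant blocks.
-- The all-a solution against n makes a and n differ in colour, and 2·n + 2c·(c + 1) + (n − 2c − 2)·c
-- = a·n with c, c + 1 red makes n blue, hence a red. Replacing summands a by the red a − 2 and
-- a − 1 shows that n − e is blue whenever a⌈e/2⌉ ≤ n. A blue k ≤ c, together with the blue n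
-- and two such blue complements, then yields a blue solution.
module Submission where

open import Defs
open import Data.Bool using (Bool; true; false)
open import Data.Bool.Properties using (¬-not)
open import Data.Fin using (Fin; zero; suc; splitAt)
open import Data.Nat using (ℕ; zero; suc; _+_; _*_; _∸_; _≤_; _<_; s≤s; s≤s⁻¹; z≤n; NonZero)
open import Data.Nat.DivMod using (_/_; _%_; m≡m%n+[m/n]*n; m%n<n; m*n/n≡m; /-monoˡ-≤)
open import Data.Nat.Properties
open import Data.Nat.Tactic.RingSolver using (solve-∀)
open import Data.Product using (Σ; ∃₂; _×_; _,_; proj₁; proj₂)
open import Data.Sum using (inj₁; inj₂)
open import Data.Sum.Properties using ([,]-map)
open import Data.Vec.Functional using (Vector; replicate; _++_)
open import Function using (_∘_)
open import Relation.Nullary using (¬_)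
open import Relation.Binary.PropositionalEquality

∑-cong : ∀ k {f g : Fin k → ℕ} → (∀ i → f i ≡ g i) → ∑ k f ≡ ∑ k g
∑-cong zero    f≗g = refl
∑-cong (suc k) f≗g = cong₂ _+_ (f≗g zero) (∑-cong k (f≗g ∘ suc))

∑-++ : ∀ p {k} (f : Vector ℕ p) (g : Vector ℕ k) → ∑ (p + k) (f ++ g) ≡ ∑ p f + ∑ k g
∑-++ zero    f g = refl
∑-++ (suc p) f g = trans
  (cong (f zero +_) (trans (∑-cong (p + _) (λ i → [,]-map (splitAt p i))) (∑-++ p (f ∘ suc) g)))
  (sym (+-assoc (f zero) _ _))

∑-replicate : ∀ k v → ∑ k (replicate k v) ≡ k * v
∑-replicate zero    v = refl
∑-replicate (suc k) v = cong (v +_) (∑-replicate k v)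

++-all : ∀ (P : ℕ → Set) {p k} {f : Vector ℕ p} {g : Vector ℕ k} →
         (∀ i → P (f i)) → (∀ i → P (g i)) → ∀ i → P ((f ++ g) i)
++-all P {p} Pf Pg i with splitAt p i
... | inj₁ j = Pf j
... | inj₂ j = Pg j

blocks : (p u q v r w : ℕ) → Vector ℕ (p + (q + r))
blocks p u q v r w = replicate p u ++ (replicate q v ++ replicate r w)

∑-blocks : ∀ p u q v r w → ∑ (p + (q + r)) (blocks p u q v r w) ≡ p * u + (q * v + r * w)
∑-blocks p u q v r w = begin
  ∑ (p + (q + r)) (blocks p u q v r w)
    ≡⟨ ∑-++ p (replicate p u) _ ⟩
  ∑ p (replicate p u) + ∑ (q + r) (replicate q v ++ replicate r w)
    ≡⟨ cong₂ _+_ (∑-replicate p u) (∑-++ q (replicate q v) (replicate r w)) ⟩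
  p * u + (∑ q (replicate q v) + ∑ r (replicate r w))
    ≡⟨ cong (p * u +_) (cong₂ _+_ (∑-replicate q v) (∑-replicate r w)) ⟩
  p * u + (q * v + r * w) ∎
  where open ≡-Reasoning

ColouredIn : ℕ → Coloring → Bool → ℕ → Set
ColouredIn N χ κ v = InRange N v × χ v ≡ κ

blockSolution : ∀ {a N χ κ} p u q v r w y →
  ColouredIn N χ κ u → ColouredIn N χ κ v → ColouredIn N χ κ w → ColouredIn N χ κ y →
  p * u + (q * v + r * w) ≡ a * y → MonoSolution (suc (p + (q + r))) a N χ
blockSolution {N = N} {χ = χ} {κ = κ} p u q v r w y cu cv cw (y∈ , χy≡κ) sum≡ =
  blocks p u q v r w , y , proj₁ ∘ coloured , y∈ , (λ i → trans (proj₂ (coloured i)) (sym χy≡κ)) ,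
  trans (∑-blocks p u q v r w) sum≡
  where
  coloured : ∀ i → ColouredIn N χ κ (blocks p u q v r w i)
  coloured = ++-all (ColouredIn N χ κ) {f = replicate p u} (λ _ → cu)
               (++-all (ColouredIn N χ κ) {f = replicate q v} {g = replicate r w} (λ _ → cv) (λ _ → cw))

≤⌈/⌉ : ∀ {x w} d → w * suc d ≤ x + d → w ≤ ⌈ x / suc d ⌉
≤⌈/⌉ {x} {w} d w*a≤x+d = begin
  w                 ≡⟨ m*n/n≡m w (suc d) ⟨
  w * suc d / suc d ≤⟨ /-monoˡ-≤ (suc d) w*a≤x+d ⟩
  (x + d) / suc d   ≡⟨ cong (λ t → (t ∸ 1) / suc d) (+-suc x d) ⟨
  ⌈ x / suc d ⌉     ∎
  where open ≤-Reasoning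

n≤C : ∀ n d → suc d * d < n → n ≤ C (suc n) (suc d)
n≤C n d a[a-1]<n = ≤⌈/⌉ d (begin
  n * suc d             ≤⟨ *-monoʳ-≤ n a≤⌈n/a⌉ ⟩
  n * ⌈ n / suc d ⌉     ≤⟨ m≤m+n _ d ⟩
  n * ⌈ n / suc d ⌉ + d ∎)
  where
  open ≤-Reasoning
  a≤⌈n/a⌉ : suc d ≤ ⌈ n / suc d ⌉
  a≤⌈n/a⌉ = ≤⌈/⌉ d (begin
    suc d * suc d       ≡⟨ *-suc (suc d) d ⟩
    suc d + suc d * d   ≡⟨ +-comm (suc d) _ ⟩
    suc d * d + suc d   ≡⟨ +-suc (suc d * d) d ⟩
    suc (suc d * d) + d ≤⟨ +-monoˡ-≤ d a[a-1]<n ⟩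
    n + d               ∎)

roundUp : ∀ x d → ∃₂ λ q r → r ≤ d × q * suc d ≡ x + r
roundUp x d = q , d ∸ ρ , m∸n≤m d ρ , +-cancelʳ-≡ ρ _ _ (begin
  q * suc d + ρ     ≡⟨ +-comm (q * suc d) ρ ⟩
  ρ + q * suc d     ≡⟨ m≡m%n+[m/n]*n (x + d) (suc d) ⟨
  x + d             ≡⟨ cong (x +_) (m∸n+n≡m (s≤s⁻¹ (m%n<n (x + d) (suc d)))) ⟨
  x + (d ∸ ρ + ρ)   ≡⟨ +-assoc x (d ∸ ρ) ρ ⟨
  x + (d ∸ ρ) + ρ   ∎)
  where
  open ≡-Reasoning
  q = (x + d) / suc d
  ρ = (x + d) % suc d

halves : ∀ e → 2 * (e / 2) + e % 2 ≡ e
halves e = begin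
  2 * (e / 2) + e % 2 ≡⟨ cong (_+ e % 2) (*-comm 2 (e / 2)) ⟩
  e / 2 * 2 + e % 2   ≡⟨ +-comm (e / 2 * 2) (e % 2) ⟩
  e % 2 + e / 2 * 2   ≡⟨ m≡m%n+[m/n]*n e 2 ⟨
  e                   ∎
  where open ≡-Reasoning

two-n-sum : ∀ c r n → 2 + (2 * c + r) ≡ n → 2 * n + (2 * c * (1 + c) + r * c) ≡ (2 + c) * n
two-n-sum c r _ refl = identity c r
  where
  identity : ∀ c r → 2 * (2 + (2 * c + r)) + (2 * c * (1 + c) + r * c) ≡ (2 + c) * (2 + (2 * c + r))
  identity = solve-∀

-- y is only known through y + e ≡ n, so both sides get a·e added, which turns the
-- goal into a semiring identity; one-z-sum is proved the same way.
near-a-sum : ∀ c i j r y n → (2 + c) * i + ((2 + c) * j + r) ≡ n → y + (2 * i + j) ≡ n →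
  (2 + c) * i * c + ((2 + c) * j * (1 + c) + r * (2 + c)) ≡ (2 + c) * y
near-a-sum c i j r y _ refl y+e≡n = +-cancelʳ-≡ (a * e) _ _ (begin
  a * i * c + (a * j * (1 + c) + r * a) + a * e ≡⟨ expand c i j r ⟩
  a * (a * i + (a * j + r))                   ≡⟨ cong (a *_) y+e≡n ⟨
  a * (y + e)                                 ≡⟨ *-distribˡ-+ a y e ⟩
  a * y + a * e                               ∎)
  where
  open ≡-Reasoning
  a = 2 + c
  e = 2 * i + j
  expand : ∀ c i j r →
    (2 + c) * i * c + ((2 + c) * j * (1 + c) + r * (2 + c)) + (2 + c) * (2 * i + j)
      ≡ (2 + c) * ((2 + c) * i + ((2 + c) * j + r))
  expand = solve-∀

one-z-sum : ∀ {c n} k t s y z e₁ e₂ → k + t ≡ c → suc t + s ≡ n →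
  y + e₁ ≡ n → z + e₂ ≡ n → e₁ * (2 + c) ≡ n + suc t * k + e₂ → 1 * z + (t * n + s * k) ≡ (2 + c) * y
one-z-sum k t s y z e₁ e₂ refl refl y+e₁≡n z+e₂≡n e₁a≡ = +-cancelʳ-≡ (a * e₁) _ _ (begin
  L + a * e₁                                ≡⟨ cong (L +_) (trans (*-comm a e₁) e₁a≡) ⟩
  L + (n + suc t * k + e₂)                  ≡⟨ regroup k t s z e₂ ⟩
  t * n + s * k + n + suc t * k + (z + e₂)  ≡⟨ cong (t * n + s * k + n + suc t * k +_) z+e₂≡n ⟩
  t * n + s * k + n + suc t * k + n         ≡⟨ collect k t s ⟩
  a * n                                     ≡⟨ cong (a *_) y+e₁≡n ⟨
  a * (y + e₁)                              ≡⟨ *-distribˡ-+ a y e₁ ⟩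
  a * y + a * e₁                            ∎)
  where
  open ≡-Reasoning
  n = suc t + s
  a = 2 + (k + t)
  L = 1 * z + (t * n + s * k)
  regroup : ∀ k t s z e₂ →
    1 * z + (t * (suc t + s) + s * k) + (suc t + s + suc t * k + e₂)
      ≡ t * (suc t + s) + s * k + (suc t + s) + suc t * k + (z + e₂)
  regroup = solve-∀
  collect : ∀ k t s →
    t * (suc t + s) + s * k + (suc t + s) + suc t * k + (suc t + s) ≡ (2 + (k + t)) * (suc t + s)
  collect = solve-∀

module RedInitialSegment {c n : ℕ} {χ : Coloring}
  (noMono : ¬ MonoSolution (suc n) (2 + c) (C (suc n) (2 + c)) χ)
  (large : (2 + c) * (1 + c) < n) (1≤c : 1 ≤ c)
  (red-c : red χ c) (red-1+c : red χ (1 + c)) where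

  private
    a = 2 + c
    N = C (suc n) a

  a≤n : a ≤ n
  a≤n = ≤-trans (m≤m*n a (1 + c)) (<⇒≤ large)

  coloured : ∀ {κ v} → 1 ≤ v → v ≤ n → χ v ≡ κ → ColouredIn N χ κ v
  coloured 1≤v v≤n χv≡κ = (1≤v , ≤-trans v≤n (n≤C n (1 + c) large)) , χv≡κ

  c≤n : c ≤ n
  c≤n = ≤-trans (n≤1+n c) (≤-trans (n≤1+n (1 + c)) a≤n)

  coloured-c : ColouredIn N χ true c
  coloured-c = coloured 1≤c c≤n red-c

  coloured-1+c : ColouredIn N χ true (1 + c)
  coloured-1+c = coloured (s≤s z≤n) (≤-trans (n≤1+n (1 + c)) a≤n) red-1+c

  noBlocks : ∀ {κ} p u q v r w y → p + (q + r) ≡ n →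
    ColouredIn N χ κ u → ColouredIn N χ κ v → ColouredIn N χ κ w → ColouredIn N χ κ y →
    ¬ (p * u + (q * v + r * w) ≡ a * y)
  noBlocks p u q v r w y count cu cv cw cy sum≡ =
    noMono (subst (λ k → MonoSolution (suc k) a N χ) count (blockSolution {a = a} p u q v r w y cu cv cw cy sum≡))

  a-and-n-differ : χ a ≢ χ n
  a-and-n-differ χa≡χn = noBlocks 0 a 0 a n a n refl ca ca ca cn (*-comm n a)
    where
    ca : ColouredIn N χ (χ n) a
    ca = coloured (s≤s z≤n) a≤n χa≡χn
    cn : ColouredIn N χ (χ n) n
    cn = coloured (≤-trans (s≤s z≤n) a≤n) ≤-refl refl

  2+2c≤n : 2 + 2 * c ≤ n
  2+2c≤n = ≤-trans (m≤m+n (2 + 2 * c) (c + c * c)) (≤-trans (≤-reflexive (expand c)) (<⇒≤ large))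
    where
    expand : ∀ c → 2 + 2 * c + (c + c * c) ≡ (2 + c) * (1 + c)
    expand = solve-∀

  n-not-red : ¬ red χ n
  n-not-red red-n with m≤n⇒∃[o]m+o≡n 2+2c≤n
  ... | r , count = noBlocks 2 n (2 * c) (1 + c) r c n count cn coloured-1+c coloured-c cn
                      (two-n-sum c r n count)
    where
    cn = coloured (≤-trans (s≤s z≤n) a≤n) ≤-refl red-n

  blue-n : χ n ≡ false
  blue-n = ¬-not n-not-red

  red-a : red χ a
  red-a = ¬-not (λ χa≡false → a-and-n-differ (trans χa≡false (sym blue-n)))

  -- a·i copies of a − 2 and a·j copies of a − 1 fall short of a·n by a·(2i + j).
  not-red-below : ∀ y i j → y + (2 * i + j) ≡ n → a * (i + j) ≤ n → 1 ≤ y → ¬ red χ y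
  not-red-below y i j y+e≡n a[i+j]≤n 1≤y red-y
    with m≤n⇒∃[o]m+o≡n (subst (_≤ n) (*-distribˡ-+ a i j) a[i+j]≤n)
  ... | r , ai+aj+r≡n =
    noBlocks (a * i) c (a * j) (1 + c) r a y count coloured-c coloured-1+c
      (coloured (s≤s z≤n) a≤n red-a) (coloured 1≤y (m+n≤o⇒m≤o y (≤-reflexive y+e≡n)) red-y)
      (near-a-sum c i j r y n count y+e≡n)
    where
    count : a * i + (a * j + r) ≡ n
    count = trans (sym (+-assoc (a * i) (a * j) r)) ai+aj+r≡n

  -- Guarantees a·⌈e/2⌉ ≤ n, the hypothesis of not-red-below for e = 2i + j with j ≤ 1.
  Short : ℕ → Set
  Short e = a * suc e ≤ 2 * n

  blue-complement : ∀ e → Short e → Σ ℕ λ y → y + e ≡ n × ColouredIn N χ false y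
  blue-complement e short = y , m∸n+n≡m e≤n , coloured 1≤y (m∸n≤m n e) blue-y
    where
    e<n : e < n
    e<n = *-cancelˡ-≤ 2 (≤-trans (*-monoˡ-≤ (suc e) (m≤m+n 2 c)) short)
    e≤n = <⇒≤ e<n
    y = n ∸ e
    1≤y : 1 ≤ y
    1≤y = m<n⇒0<n∸m e<n
    i = e / 2
    j = e % 2
    2[i+j]≤1+e : 2 * (i + j) ≤ suc e
    2[i+j]≤1+e = begin
      2 * (i + j)           ≡⟨ *-distribˡ-+ 2 i j ⟩
      2 * i + (j + (j + 0)) ≡⟨ cong (2 * i +_) (cong (j +_) (+-identityʳ j)) ⟩
      2 * i + (j + j)       ≡⟨ +-assoc (2 * i) j j ⟨
      2 * i + j + j         ≡⟨ cong (_+ j) (halves e) ⟩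
      e + j                 ≤⟨ +-monoʳ-≤ e (s≤s⁻¹ (m%n<n e 2)) ⟩
      e + 1                 ≡⟨ +-comm e 1 ⟩
      suc e                 ∎
      where open ≤-Reasoning
    blue-y : χ y ≡ false
    blue-y = ¬-not (not-red-below y i j
      (trans (cong (y +_) (halves e)) (m∸n+n≡m e≤n))
      (*-cancelˡ-≤ 2 (begin
        2 * (a * (i + j)) ≡⟨ *-assoc 2 a (i + j) ⟨
        2 * a * (i + j)   ≡⟨ cong (_* (i + j)) (*-comm 2 a) ⟩
        a * 2 * (i + j)   ≡⟨ *-assoc a 2 (i + j) ⟩
        a * (2 * (i + j)) ≤⟨ *-monoʳ-≤ a 2[i+j]≤1+e ⟩
        a * suc e         ≤⟨ short ⟩
        2 * n             ∎))
      1≤y)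
      where open ≤-Reasoning

  short-≤1+c : ∀ e → e ≤ 1 + c → Short e
  short-≤1+c e e≤1+c = begin
    a * suc e         ≤⟨ *-monoʳ-≤ a (s≤s e≤1+c) ⟩
    a * a             ≡⟨ *-suc a (1 + c) ⟩
    a + a * (1 + c)   ≤⟨ +-mono-≤ a≤n (<⇒≤ large) ⟩
    n + n             ≡⟨ cong (n +_) (+-identityʳ n) ⟨
    2 * n             ∎
    where open ≤-Reasoning

  short-of-bound : ∀ e → e * a ≤ n + c * c + (1 + c) → Short e
  short-of-bound e e*a≤ = begin
    a * suc e                     ≡⟨ *-suc a e ⟩
    a + a * e                     ≡⟨ cong (a +_) (*-comm a e) ⟩
    a + e * a                     ≤⟨ +-monoʳ-≤ a e*a≤ ⟩
    a + (n + c * c + (1 + c))     ≡⟨ regroup n c ⟩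
    n + (c * c + (1 + c) + a)     ≤⟨ +-monoʳ-≤ n (≤-trans (m≤m+n _ c) (≤-reflexive (room c))) ⟩
    n + suc ((2 + c) * (1 + c))   ≤⟨ +-monoʳ-≤ n large ⟩
    n + n                         ≡⟨ cong (n +_) (+-identityʳ n) ⟨
    2 * n                         ∎
    where
    open ≤-Reasoning
    regroup : ∀ n c → 2 + c + (n + c * c + (1 + c)) ≡ n + (c * c + (1 + c) + (2 + c))
    regroup = solve-∀
    room : ∀ c → c * c + (1 + c) + (2 + c) + c ≡ suc ((2 + c) * (1 + c))
    room = solve-∀

  -- With t = c − k, s = n − t − 1, e₁ = ⌈(n + (t + 1) k) / a⌉ and e₂ = a e₁ − n − (t + 1) k,
  -- a blue k would give the blue solution (n − e₂) + t·n + s·k = a (n − e₁).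
  not-blue-below : ∀ k → 1 ≤ k → k ≤ c → χ k ≢ false
  not-blue-below k 1≤k k≤c blue-k =
    let t , k+t≡c = m≤n⇒∃[o]m+o≡n k≤c
        1+t≤c = subst (suc t ≤_) k+t≡c (+-monoˡ-≤ t 1≤k)
        s , 1+t+s≡n = m≤n⇒∃[o]m+o≡n (≤-trans 1+t≤c c≤n)
        e₁ , e₂ , e₂≤1+c , e₁a≡ = roundUp (n + suc t * k) (1 + c)
        [1+t]k≤cc = *-mono-≤ 1+t≤c k≤c
        e₁a≤ = ≤-trans (≤-reflexive e₁a≡) (+-mono-≤ (+-monoʳ-≤ n [1+t]k≤cc) e₂≤1+c)
        y , y+e₁≡n , blue-y = blue-complement e₁ (short-of-bound e₁ e₁a≤)
        z , z+e₂≡n , blue-z = blue-complement e₂ (short-≤1+c e₂ e₂≤1+c)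
    in noBlocks 1 z t n s k y 1+t+s≡n blue-z
         (coloured (≤-trans (s≤s z≤n) a≤n) ≤-refl blue-n)
         (coloured 1≤k (≤-trans k≤c c≤n) blue-k)
         blue-y
         (one-z-sum k t s y z e₁ e₂ k+t≡c 1+t+s≡n y+e₁≡n z+e₂≡n e₁a≡)

  red-initial : ∀ k → 1 ≤ k → k ≤ a → red χ k
  red-initial k 1≤k k≤a with m≤n⇒m<n∨m≡n k≤a
  ... | inj₂ refl = red-a
  ... | inj₁ (s≤s k≤1+c) with m≤n⇒m<n∨m≡n k≤1+c
  ...   | inj₂ refl = red-1+c
  ...   | inj₁ (s≤s k≤c) = ¬-not (not-blue-below k 1≤k k≤c)

lemma4 : (a m : ℕ) → .{{_ : NonZero a}} → 4 ≤ a → a * a ∸ a + 2 ≤ m →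
    (χ : Coloring) →
    ¬ MonoSolution m a (C m a) χ →
    red χ (a ∸ 2) → red χ (a ∸ 1) →
    (k : ℕ) → 1 ≤ k → k ≤ a → red χ k
lemma4 a zero _ a²-a+2≤0 with m+n≤o⇒n≤o (a * a ∸ a) a²-a+2≤0
... | ()
lemma4 (suc (suc c)) (suc n) (s≤s (s≤s 2≤c)) a²-a+2≤m χ noMono red-c red-1+c =
  RedInitialSegment.red-initial noMono large (≤-trans (s≤s z≤n) 2≤c) red-c red-1+c
  where
  a = 2 + c
  large : a * (1 + c) < n
  large = s≤s⁻¹ (begin
    suc (suc (a * (1 + c)))  ≡⟨ +-comm 2 (a * (1 + c)) ⟩
    a * (1 + c) + 2          ≡⟨ cong (_+ 2) (m+n∸m≡n a (a * (1 + c))) ⟨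
    a + a * (1 + c) ∸ a + 2  ≡⟨ cong (λ t → t ∸ a + 2) (*-suc a (1 + c)) ⟨
    a * a ∸ a + 2            ≤⟨ a²-a+2≤m ⟩
    suc n                    ∎)
    where open ≤-Reasoning
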